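{- Let $p,u$ be PPC_dB terms and $n\in\mathbb N$. Then $\{p/\uparrow^{\mathsf v}u\}_n=\uparrow^{\mathsf v}(\{p/u\}_n)$.
   Context: **PPC_dB terms.** Terms: $t::=\mathsf v_{i,j}\mid\mathsf m_{i,j}\mid t\,t\mid\lambda_np.s$, with $i,j\ge1$ and $n\in\mathbb N$. **Increments.** - $\uparrow^{\mathsf v}_k\mathsf v_{i,j}=\mathsf v_{i+1,j}$ if $i>k$, else unchanged; matchable indices unchanged; homomorphic on applications; $\uparrow^{\mathsf v}_k(\lambda_np.s)=\lambda_n\uparrow^{\mathsf v}_kp.\uparrow^{\mathsf v}_{k+1}s$. - $\uparrow^{\mathsf v}$ means $\uparrow^{\mathsf v}_0$. - On a substitution at level $1$: $\uparrow^{\mathsf v}_k\sigma=\{\mathsf v_{1,j}\mapsto\uparrow^{\mathsf v}_k(\sigma(\mathsf v_{1,j}))\}_{\mathsf v_{1,j}\in dom(\sigma)}$. - $\uparrow^{\mathsf v}_k\mathtt{fail}=\mathtt{fail}$ and $\uparrow^{\mathsf v}_k\mathtt{wait}=\mathtt{wait}$. **Matching.** A match is a substitution, $\mathtt{fail}$ or $\mathtt{wait}$. Data structures are $d::=\mathsf m_{i,j}\mid d\,t$; matchable forms are $m::=d\mid\lambda_nt.t$. $\mu\uplus\mu'$ is $\mathtt{fail}$ if either match is $\mathtt{fail}$; else $\mathtt{wait}$ if either is $\mathtt{wait}$; else $\mathtt{fail}$ if the domains intersect; else the union. Matching $\{p/u\}_n$ (first applicable clause): 1. $\{\mathsf m_{1,j}/u\}_n=\{\mathsf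 v_{1,j}\mapsto u\}$; 2. $\{\mathsf m_{i+1,j}/\mathsf m_{i,j}\}_n=\{\}$; 3. $\{p\,q/t\,u\}_n=\{p/t\}_n\uplus\{q/u\}_n$ if both are matchable forms; 4. $\mathtt{fail}$ if $p,u$ are matchable forms; 5. $\mathtt{wait}$ otherwise. A substitution result whose domain is not $\{\mathsf v_{1,1},\dots,\mathsf v_{1,n}\}$ becomes $\mathtt{fail}$. -}

module Defs where

open import Data.Nat using (ℕ; zero; suc; _≤ᵇ_; _<ᵇ_; _≡ᵇ_)
open import Data.Bool using (Bool; true; false; _∧_; _∨_; not; if_then_else_)
open import Data.List using (List; []; _∷_; map; _++_; upTo)
open import Data.Bool.ListAction using (all; any)
open import Data.Product using (_×_; _,_; proj₁; proj₂)
open import Data.List.Membership.Propositional using (_∈_)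
open import Relation.Binary.PropositionalEquality using (_≡_)
open import Function.Bundles using (_⇔_)

-- PPC_dB terms.  INDEX CONVENTION (shifted by one):
--   v i j  represents  v_{i+1, j+1}   (so v 0 j is v_{1,j+1})
--   m i j  represents  m_{i+1, j+1}
--   lam n p s  represents  λ_n p . s
data Term : Set where
  v   : ℕ → ℕ → Term
  m   : ℕ → ℕ → Term
  _·_ : Term → Term → Term
  lam : ℕ → Term → Term → Term

infixl 7 _·_

-- ↑^v_k.  Real index i+1 > k  iff  k ≤ i (stored index i).
incV : ℕ → Term → Term
incV k (v i j)     = if k ≤ᵇ i then v (suc i) j else v i j
incV k (m i j)     = m i j
incV k (t · u)     = incV k t · incV k u
incV k (lam n p s) = lam n (incV k p) (incV (suc k) s)

incV0 : Term → Term
incV0 = incV 0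

-- A substitution at level 1: association list  (j , t)  meaning  v_{1,j+1} ↦ t.
Subst : Set
Subst = List (ℕ × Term)

dom : Subst → List ℕ
dom = map proj₁

data Match : Set where
  sub  : Subst → Match
  fail : Match
  wait : Match

incVSubst : ℕ → Subst → Subst
incVSubst k = map (λ { (j , t) → (j , incV k t) })

incVMatch : ℕ → Match → Match
incVMatch k (sub σ) = sub (incVSubst k σ)
incVMatch k fail    = fail
incVMatch k wait    = wait

isData : Term → Bool
isData (m i j)     = true
isData (t · u)     = isData t
isData (v i j)     = false
isData (lam n p s) = false

isMatchable : Term → Bool
isMatchable (lam n p s) = true
isMatchable t           = isData t

elemᵇ : ℕ → List ℕ → Bool
elemᵇ x = any (λ y → x ≡ᵇ y)

disjointᵇ : List ℕ → List ℕ → Bool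
disjointᵇ xs ys = all (λ x → not (elemᵇ x ys)) xs

_⊎ₘ_ : Match → Match → Match
fail  ⊎ₘ _     = fail
_     ⊎ₘ fail  = fail
wait  ⊎ₘ _     = wait
_     ⊎ₘ wait  = wait
sub σ ⊎ₘ sub τ = if disjointᵇ (dom σ) (dom τ) then sub (σ ++ τ) else fail

-- The clauses of {p/u}, tried in order (before the final domain check).
matchRaw : Term → Term → Match
matchRaw (m zero j) u = sub ((j , u) ∷ [])
matchRaw (m (suc i) j) (m i' j') =
  -- clause 2: stored (suc i) vs i' means real i+2 vs i'+1
  if (i ≡ᵇ i') ∧ (j ≡ᵇ j') then sub []
  else fail
matchRaw (p · q) (t · u) =
  if isMatchable (p · q) ∧ isMatchable (t · u)
  then matchRaw p t ⊎ₘ matchRaw q u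
  else wait
matchRaw p u = if isMatchable p ∧ isMatchable u then fail else wait

-- domain(σ) = {v_{1,1},…,v_{1,n}}  (as a set; stored keys 0..n-1)
domIsᵇ : ℕ → List ℕ → Bool
domIsᵇ n ks = all (λ k → k <ᵇ n) ks ∧ all (λ k → elemᵇ k ks) (upTo n)

match : ℕ → Term → Term → Match
match n p u with matchRaw p u
... | sub σ = if domIsᵇ n (dom σ) then sub σ else fail
... | fail  = fail
... | wait  = wait

-- Equality of matches; substitutions are compared as finite maps
-- (same set of bindings), not as lists.
data _≈ₘ_ : Match → Match → Set where
  fail≈ : fail ≈ₘ fail
  wait≈ : wait ≈ₘ wait
  sub≈  : ∀ {σ τ} → (∀ (b : ℕ × Term) → (b ∈ σ) ⇔ (b ∈ τ)) → sub σ ≈ₘ sub τ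

-- Shifting only renumbers variables, so it preserves the shape of a term: whether it is a
-- data structure or a matchable form, and its matchable symbols. Every clause of matching
-- is chosen by this shape alone and merely copies parts of the argument into the result,
-- hence matching commutes with the shift, and so does the final domain check.
module Submission where

open import Data.Nat using (ℕ; zero; suc; _≤ᵇ_; _≡ᵇ_)
open import Data.Bool using (Bool; true; false; _∧_; if_then_else_)
open import Data.Bool.Properties using (∧-zeroʳ)
open import Data.List using (_++_)
open import Data.List.Properties using (map-++; map-∘)
open import Relation.Binary.PropositionalEquality using (_≡_; refl; sym; trans; cong; cong₂; subst)
open import Function.Base using (id)
open import Function.Bundles using (mk⇔)
open import Defs

isData-incV : ∀ k u → isData (incV k u) ≡ isData u
isData-incV k (v i j) with k ≤ᵇ i
... | true  = refl
... | false = refl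
isData-incV k (m i j)     = refl
isData-incV k (t · u)     = isData-incV k t
isData-incV k (lam n p s) = refl

isMatchable-incV : ∀ k u → isMatchable (incV k u) ≡ isMatchable u
isMatchable-incV k (v i j) with k ≤ᵇ i
... | true  = refl
... | false = refl
isMatchable-incV k (m i j)     = refl
isMatchable-incV k (t · u)     = isData-incV k t
isMatchable-incV k (lam n p s) = refl

dom-incVSubst : ∀ k σ → dom (incVSubst k σ) ≡ dom σ
dom-incVSubst k σ = sym (map-∘ σ)

incVSubst-++ : ∀ k σ τ → incVSubst k (σ ++ τ) ≡ incVSubst k σ ++ incVSubst k τ
incVSubst-++ k σ τ = map-++ _ σ τ

incVMatch-⊎ₘ : ∀ k μ ν → incVMatch k (μ ⊎ₘ ν) ≡ incVMatch k μ ⊎ₘ incVMatch k ν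
incVMatch-⊎ₘ k fail    ν       = refl
incVMatch-⊎ₘ k wait    fail    = refl
incVMatch-⊎ₘ k wait    wait    = refl
incVMatch-⊎ₘ k wait    (sub τ) = refl
incVMatch-⊎ₘ k (sub σ) fail    = refl
incVMatch-⊎ₘ k (sub σ) wait    = refl
incVMatch-⊎ₘ k (sub σ) (sub τ)
  rewrite dom-incVSubst k σ | dom-incVSubst k τ with disjointᵇ (dom σ) (dom τ)
... | true  = cong sub (incVSubst-++ k σ τ)
... | false = refl

failOrWait-incV : ∀ k (b : Bool) u → (if b ∧ isMatchable (incV k u) then fail else wait)
                            ≡ incVMatch k (if b ∧ isMatchable u then fail else wait)
failOrWait-incV k b u rewrite isMatchable-incV k u with b ∧ isMatchable u
... | true  = refl
... | false = refl

matchRaw-incV : ∀ k p u → matchRaw p (incV k u) ≡ incVMatch k (matchRaw p u)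
matchRaw-incV k (m zero j)    u           = refl
matchRaw-incV k (m (suc i) j) (m i′ j′) with (i ≡ᵇ i′) ∧ (j ≡ᵇ j′)
... | true  = refl
... | false = refl
matchRaw-incV k (m (suc i) j) (v i′ j′) with k ≤ᵇ i′
... | true  = refl
... | false = refl
matchRaw-incV k (m (suc i) j) (t · u)     = failOrWait-incV k true (t · u)
matchRaw-incV k (m (suc i) j) (lam n q s) = refl
matchRaw-incV k (v i j)       u           = refl
matchRaw-incV k (lam n q s)   u           = failOrWait-incV k true u
matchRaw-incV k (p · q) (t · u) rewrite isData-incV k t with isData p ∧ isData t
... | true  = trans (cong₂ _⊎ₘ_ (matchRaw-incV k p t) (matchRaw-incV k q u))
                    (sym (incVMatch-⊎ₘ k (matchRaw p t) (matchRaw q u)))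
... | false = refl
matchRaw-incV k (p · q) (v i j) with k ≤ᵇ i
... | true  rewrite ∧-zeroʳ (isData p) = refl
... | false rewrite ∧-zeroʳ (isData p) = refl
matchRaw-incV k (p · q) (m i j)     = failOrWait-incV k (isData p) (m i j)
matchRaw-incV k (p · q) (lam n r s) = failOrWait-incV k (isData p) (lam n r s)

match-incV : ∀ k n p u → match n p (incV k u) ≡ incVMatch k (match n p u)
match-incV k n p u rewrite matchRaw-incV k p u with matchRaw p u
... | fail  = refl
... | wait  = refl
... | sub σ rewrite dom-incVSubst k σ with domIsᵇ n (dom σ)
...   | true  = refl
...   | false = refl

≈ₘ-refl : ∀ μ → μ ≈ₘ μ
≈ₘ-refl (sub σ) = sub≈ (λ b → mk⇔ id id)
≈ₘ-refl fail    = fail≈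
≈ₘ-refl wait    = wait≈

lemma5p1 : (p u : Term) (n : ℕ) → match n p (incV0 u) ≈ₘ incVMatch 0 (match n p u)
lemma5p1 p u n = subst (_≈ₘ incVMatch 0 (match n p u)) (sym (match-incV 0 n p u))
                       (≈ₘ-refl (incVMatch 0 (match n p u)))
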